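{- For all formulae $\varphi,\psi\in\mathcal{L}$ and all $r,q\in\mathbb{Q}_{\ge0}$, the following are derivable in the axiomatic system: (T1) $\vdash(L_r\varphi\wedge L_q\psi\wedge L_0(\varphi\wedge\psi))\to L_{\max\{r,q\}}(\varphi\wedge\psi)$; (T1$'$) $\vdash(M_r\varphi\wedge M_q\psi\wedge L_0(\varphi\wedge\psi))\to M_{\min\{r,q\}}(\varphi\wedge\psi)$; (T2) if $\vdash\varphi\leftrightarrow\psi$ then $\vdash L_r\varphi\leftrightarrow L_r\psi$; (T2$'$) if $\vdash\varphi\leftrightarrow\psi$ then $\vdash M_r\varphi\leftrightarrow M_r\psi$; (T3) $\vdash\neg L_r\bot$; (T4) if $\vdash\varphi\to\bot$ then $\vdash\neg L_r\varphi$; (T5) $\vdash M_r(\varphi\vee\psi)\to M_r\varphi\vee M_r\psi$.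
   Context: Fix a countable set $\mathcal{AP}$ of atomic propositions. Formulae of $\mathcal{L}$: $\varphi::= p\mid\neg\varphi\mid\varphi\wedge\varphi\mid L_r\varphi\mid M_r\varphi$ with $p\in\mathcal{AP}$, $r\in\mathbb{Q}_{\ge0}$; $\bot,\vee,\to,\leftrightarrow$ defined as usual. Axiomatic system: $\vdash\varphi$ means $\varphi$ belongs to the smallest set of formulae containing all instances of propositional tautologies and of the axioms below, closed under modus ponens and the rules below (all $r,q\in\mathbb{Q}_{\ge0}$): (A1) $\neg L_0\bot$; (A2) $L_{r+q}\varphi\to L_r\varphi$ if $q>0$; (A2$'$) $M_r\varphi\to M_{r+q}\varphi$ if $q>0$; (A3) $L_r\varphi\wedge L_q\psi\to L_{\min\{r,q\}}(\varphi\vee\psi)$; (A3$'$) $M_r\varphi\wedge M_q\psi\to M_{\max\{r,q\}}(\varphi\vee\psi)$; (A4) $L_r(\varphi\vee\psi)\to L_r\varphi\vee L_r\psi$; (A5) $\neg L_0\psi\to(L_r\varphi\to L_r(\varphi\vee\psi))$; (A5$'$) $\neg L_0\psi\to(M_r\varphi\to M_r(\varphi\vee\psi))$; (A6) $L_{r+q}\varphi\to\neg M_r\varphi$ if $q>0$; (A7) $M_r\varphi\to L_0\varphi$; (R1) from $\vdash\varphi\to\psi$ infer $\vdash(L_r\psi\wedge L_0\varphi)\to L_r\varphi$; (R1$'$) from $\vdash\varphi\to\psi$ infer $\vdash(M_r\psi\wedge L_0\varphi)\to M_r\varphi$; (R2) from $\vdash\varphi\to\psi$ infer $\vdash L_0\varphi\to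 L_0\psi$. -}

module Defs where

open import Data.Nat using (ℕ)
open import Data.Bool using (Bool; true; false; not; _∧_)
open import Data.Sum using (_⊎_; inj₁; inj₂)
open import Relation.Binary.PropositionalEquality using (_≡_; subst; sym)
open import Data.Rational using (ℚ; 0ℚ; _≤_; _<_; _⊓_; _⊔_)
  renaming (_+_ to _+ℚ_)
open import Data.Rational.Properties using (+-mono-≤; ⊓-sel; ⊔-sel)

-- Non-negative rationals ℚ≥0 : a rational together with an (irrelevant)
-- proof of 0 ≤ r, so that equality is equality of the underlying rational.

record ℚ≥0 : Set where
  constructor _,≥0_
  field
    val      : ℚ
    .nonneg  : 0ℚ ≤ val
open ℚ≥0 public

zero≥0 : ℚ≥0
zero≥0 = 0ℚ ,≥0 Data.Rational.Properties.≤-refl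

_+≥0_ : ℚ≥0 → ℚ≥0 → ℚ≥0
(r ,≥0 p) +≥0 (q ,≥0 p′) = (r +ℚ q) ,≥0 +-mono-≤ p p′

private
  selNonneg : ∀ (f : ℚ → ℚ → ℚ) (r q : ℚ) → (f r q ≡ r) ⊎ (f r q ≡ q) →
              0ℚ ≤ r → 0ℚ ≤ q → 0ℚ ≤ f r q
  selNonneg f r q (inj₁ e) pr pq = subst (0ℚ ≤_) (sym e) pr
  selNonneg f r q (inj₂ e) pr pq = subst (0ℚ ≤_) (sym e) pq

min≥0 : ℚ≥0 → ℚ≥0 → ℚ≥0
min≥0 (r ,≥0 p) (q ,≥0 p′) = (r ⊓ q) ,≥0 selNonneg _⊓_ r q (⊓-sel r q) p p′

max≥0 : ℚ≥0 → ℚ≥0 → ℚ≥0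
max≥0 (r ,≥0 p) (q ,≥0 p′) = (r ⊔ q) ,≥0 selNonneg _⊔_ r q (⊔-sel r q) p p′

Pos : ℚ≥0 → Set
Pos q = 0ℚ < val q

AP : Set
AP = ℕ

data Form : Set where
  var : AP → Form
  ¬′_ : Form → Form
  _∧′_ : Form → Form → Form
  L   : ℚ≥0 → Form → Form
  M   : ℚ≥0 → Form → Form

infixr 6 _∧′_
infixr 5 _∨′_
infixr 4 _⇒_ _⇔_

⊥′ : Form
⊥′ = var 0 ∧′ (¬′ var 0)

_∨′_ : Form → Form → Form
φ ∨′ ψ = ¬′ ((¬′ φ) ∧′ (¬′ ψ))

_⇒_ : Form → Form → Form
φ ⇒ ψ = ¬′ (φ ∧′ (¬′ ψ))

_⇔_ : Form → Form → Form
φ ⇔ ψ = (φ ⇒ ψ) ∧′ (ψ ⇒ φ)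

-- Instances of propositional tautologies: formulas true under every
-- Boolean valuation that is compositional for ¬ and ∧ (atoms and the
-- modal formulas L_r φ, M_r φ are treated as propositional letters).

record Valuation : Set where
  field
    ev    : Form → Bool
    ev-¬  : ∀ φ → ev (¬′ φ) ≡ not (ev φ)
    ev-∧  : ∀ φ ψ → ev (φ ∧′ ψ) ≡ ev φ ∧ ev ψ

Tautology : Form → Set
Tautology φ = (v : Valuation) → Valuation.ev v φ ≡ true

data ⊢_ : Form → Set where
  taut : ∀ {φ} → Tautology φ → ⊢ φ
  mp   : ∀ {φ ψ} → ⊢ (φ ⇒ ψ) → ⊢ φ → ⊢ ψ
  A1   : ⊢ ¬′ L zero≥0 ⊥′
  A2   : ∀ {φ} r q → Pos q → ⊢ (L (r +≥0 q) φ ⇒ L r φ)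
  A2′  : ∀ {φ} r q → Pos q → ⊢ (M r φ ⇒ M (r +≥0 q) φ)
  A3   : ∀ {φ ψ} r q → ⊢ ((L r φ ∧′ L q ψ) ⇒ L (min≥0 r q) (φ ∨′ ψ))
  A3′  : ∀ {φ ψ} r q → ⊢ ((M r φ ∧′ M q ψ) ⇒ M (max≥0 r q) (φ ∨′ ψ))
  A4   : ∀ {φ ψ} r → ⊢ (L r (φ ∨′ ψ) ⇒ (L r φ ∨′ L r ψ))
  A5   : ∀ {φ ψ} r → ⊢ ((¬′ L zero≥0 ψ) ⇒ (L r φ ⇒ L r (φ ∨′ ψ)))
  A5′  : ∀ {φ ψ} r → ⊢ ((¬′ L zero≥0 ψ) ⇒ (M r φ ⇒ M r (φ ∨′ ψ)))
  A6   : ∀ {φ} r q → Pos q → ⊢ (L (r +≥0 q) φ ⇒ ¬′ M r φ)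
  A7   : ∀ {φ} r → ⊢ (M r φ ⇒ L zero≥0 φ)
  R1   : ∀ {φ ψ} r → ⊢ (φ ⇒ ψ) → ⊢ ((L r ψ ∧′ L zero≥0 φ) ⇒ L r φ)
  R1′  : ∀ {φ ψ} r → ⊢ (φ ⇒ ψ) → ⊢ ((M r ψ ∧′ L zero≥0 φ) ⇒ M r φ)
  R2   : ∀ {φ ψ} → ⊢ (φ ⇒ ψ) → ⊢ (L zero≥0 φ ⇒ L zero≥0 ψ)

infix 2 ⊢_

module Submission where

-- Every clause of the lemma is a short derivation from one
-- or two modal axioms/rules glued together by propositional reasoning:
--   (T1)/(T1′) are R1/R1′ applied to φ ∧ ψ → φ (or → ψ), at whichever of
--       r, q the maximum/minimum selects;
--   (T2)/(T2′) use R2 to move the implication under L₀, which the guard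
--       L₀ of R1/R1′ needs; L₀ is available from L_r (by A2) or M_r (by A7);
--   (T3)/(T4) push L_r φ down to L₀ φ, then to L₀ ⊥ (R2), contradicting A1;
--   (T5) splits L₀(φ ∨ ψ) (from A7) with A4 and uses R1′ in each case.

open import Defs
open import Data.Product using (_×_; _,_)
open import Data.Nat using (ℕ; zero; suc)
open import Data.Fin using (Fin; zero; suc)
open import Data.Vec using (Vec; []; _∷_; lookup; map)
open import Data.Vec.Properties using (lookup-map)
open import Data.Bool using (Bool; true; false; not; _∧_)
open import Data.Bool.Properties using (∧-conicalˡ; ∧-conicalʳ)
open import Data.Sum using (_⊎_; inj₁; inj₂)
open import Data.Empty using (⊥-elim)
open import Relation.Binary.PropositionalEquality
  using (_≡_; refl; sym; trans; cong; cong₂; subst)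
open import Relation.Binary.Definitions using (tri<; tri≈; tri>)
open import Relation.Nullary.Decidable using (recompute)
import Data.Rational as ℚ
import Data.Rational.Properties as ℚP

-- Propositional skeletons over n letters; instantiating the letters by
-- formulas of L yields formulas whose shape is purely propositional.
data Skeleton (n : ℕ) : Set where
  letter : Fin n → Skeleton n
  neg    : Skeleton n → Skeleton n
  and    : Skeleton n → Skeleton n → Skeleton n

imp : ∀ {n} → Skeleton n → Skeleton n → Skeleton n
imp a b = neg (and a (neg b))

or : ∀ {n} → Skeleton n → Skeleton n → Skeleton n
or a b = neg (and (neg a) (neg b))

p₀ : ∀ {n} → Skeleton (suc n)
p₀ = letter zero

p₁ : ∀ {n} → Skeleton (suc (suc n))
p₁ = letter (suc zero)

p₂ : ∀ {n} → Skeleton (suc (suc (suc n)))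
p₂ = letter (suc (suc zero))

p₃ : ∀ {n} → Skeleton (suc (suc (suc (suc n))))
p₃ = letter (suc (suc (suc zero)))

_⟨_⟩ : ∀ {n} → Skeleton n → Vec Form n → Form
letter i ⟨ ρ ⟩ = lookup ρ i
neg a    ⟨ ρ ⟩ = ¬′ (a ⟨ ρ ⟩)
and a b  ⟨ ρ ⟩ = (a ⟨ ρ ⟩) ∧′ (b ⟨ ρ ⟩)

truth : ∀ {n} → Skeleton n → Vec Bool n → Bool
truth (letter i) β = lookup β i
truth (neg a)    β = not (truth a β)
truth (and a b)  β = truth a β ∧ truth b β

valuation-instance : ∀ {n} (v : Valuation) (a : Skeleton n) (ρ : Vec Form n) →
  Valuation.ev v (a ⟨ ρ ⟩) ≡ truth a (map (Valuation.ev v) ρ)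
valuation-instance v (letter i) ρ = sym (lookup-map i (Valuation.ev v) ρ)
valuation-instance v (neg a) ρ =
  trans (Valuation.ev-¬ v _) (cong not (valuation-instance v a ρ))
valuation-instance v (and a b) ρ =
  trans (Valuation.ev-∧ v _ _)
        (cong₂ _∧_ (valuation-instance v a ρ) (valuation-instance v b ρ))

holdsEverywhere : (n : ℕ) → (Vec Bool n → Bool) → Bool
holdsEverywhere zero    f = f []
holdsEverywhere (suc n) f =
  holdsEverywhere n (λ β → f (true ∷ β)) ∧ holdsEverywhere n (λ β → f (false ∷ β))

holdsEverywhere-sound : ∀ n f → holdsEverywhere n f ≡ true → ∀ β → f β ≡ true
holdsEverywhere-sound zero    f ok [] = ok
holdsEverywhere-sound (suc n) f ok (true ∷ β) =
  holdsEverywhere-sound n _ (∧-conicalˡ _ _ ok) β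
holdsEverywhere-sound (suc n) f ok (false ∷ β) =
  holdsEverywhere-sound n _ (∧-conicalʳ _ _ ok) β

-- Every instance of a skeleton passing the truth-table check is derivable.
-- The check is run by normalisation, so callers supply just `refl`.
tautology : ∀ {n} (a : Skeleton n) → holdsEverywhere n (truth a) ≡ true →
  (ρ : Vec Form n) → ⊢ a ⟨ ρ ⟩
tautology {n} a ok ρ =
  taut λ v → trans (valuation-instance v a ρ) (holdsEverywhere-sound n (truth a) ok _)

⇒-refl : ∀ {a} → ⊢ (a ⇒ a)
⇒-refl {a} = tautology (imp p₀ p₀) refl (a ∷ [])

⇒-trans : ∀ {a b c} → ⊢ (a ⇒ b) → ⊢ (b ⇒ c) → ⊢ (a ⇒ c)
⇒-trans {a} {b} {c} ab bc =
  mp (mp (tautology (imp (imp p₀ p₁) (imp (imp p₁ p₂) (imp p₀ p₂))) refl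
                    (a ∷ b ∷ c ∷ [])) ab) bc

⇒-∧-intro : ∀ {a b c} → ⊢ (a ⇒ b) → ⊢ (a ⇒ c) → ⊢ (a ⇒ (b ∧′ c))
⇒-∧-intro {a} {b} {c} ab ac =
  mp (mp (tautology (imp (imp p₀ p₁) (imp (imp p₀ p₂) (imp p₀ (and p₁ p₂)))) refl
                    (a ∷ b ∷ c ∷ [])) ab) ac

∧-elimˡ : ∀ {a b} → ⊢ ((a ∧′ b) ⇒ a)
∧-elimˡ {a} {b} = tautology (imp (and p₀ p₁) p₀) refl (a ∷ b ∷ [])

∧-elimʳ : ∀ {a b} → ⊢ ((a ∧′ b) ⇒ b)
∧-elimʳ {a} {b} = tautology (imp (and p₀ p₁) p₁) refl (a ∷ b ∷ [])

∧-forget-middle : ∀ {a b c} → ⊢ ((a ∧′ b ∧′ c) ⇒ (a ∧′ c))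
∧-forget-middle {a} {b} {c} =
  tautology (imp (and p₀ (and p₁ p₂)) (and p₀ p₂)) refl (a ∷ b ∷ c ∷ [])

∧-forget-first : ∀ {a b c} → ⊢ ((a ∧′ b ∧′ c) ⇒ (b ∧′ c))
∧-forget-first {a} {b} {c} =
  tautology (imp (and p₀ (and p₁ p₂)) (and p₁ p₂)) refl (a ∷ b ∷ c ∷ [])

∨-introˡ : ∀ {a b} → ⊢ (a ⇒ (a ∨′ b))
∨-introˡ {a} {b} = tautology (imp p₀ (or p₀ p₁)) refl (a ∷ b ∷ [])

∨-introʳ : ∀ {a b} → ⊢ (b ⇒ (a ∨′ b))
∨-introʳ {a} {b} = tautology (imp p₁ (or p₀ p₁)) refl (a ∷ b ∷ [])

∨-cases : ∀ {a c d x} → ⊢ (a ⇒ (c ∨′ d)) →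
  ⊢ ((a ∧′ c) ⇒ x) → ⊢ ((a ∧′ d) ⇒ x) → ⊢ (a ⇒ x)
∨-cases {a} {c} {d} {x} split left right =
  mp (mp (mp (tautology (imp (imp p₀ (or p₁ p₂))
                         (imp (imp (and p₀ p₁) p₃)
                         (imp (imp (and p₀ p₂) p₃) (imp p₀ p₃)))) refl
                        (a ∷ c ∷ d ∷ x ∷ [])) split) left) right

⇔-intro : ∀ {a b} → ⊢ (a ⇒ b) → ⊢ (b ⇒ a) → ⊢ (a ⇔ b)
⇔-intro {a} {b} ab ba =
  mp (mp (tautology (imp (imp p₀ p₁) (imp (imp p₁ p₀) (and (imp p₀ p₁) (imp p₁ p₀))))
                    refl (a ∷ b ∷ [])) ab) ba

⇔-elim→ : ∀ {a b} → ⊢ (a ⇔ b) → ⊢ (a ⇒ b)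
⇔-elim→ {a} {b} = mp (tautology (imp (and (imp p₀ p₁) (imp p₁ p₀)) (imp p₀ p₁)) refl (a ∷ b ∷ []))

⇔-elim← : ∀ {a b} → ⊢ (a ⇔ b) → ⊢ (b ⇒ a)
⇔-elim← {a} {b} = mp (tautology (imp (and (imp p₀ p₁) (imp p₁ p₀)) (imp p₁ p₀)) refl (a ∷ b ∷ []))

contrapose : ∀ {a b} → ⊢ (a ⇒ b) → ⊢ (¬′ b) → ⊢ (¬′ a)
contrapose {a} {b} ab nb =
  mp (mp (tautology (imp (imp p₀ p₁) (imp (neg p₁) (neg p₀))) refl (a ∷ b ∷ [])) ab) nb

ℚ≥0-ext : ∀ {r s : ℚ≥0} → val r ≡ val s → r ≡ s
ℚ≥0-ext {a ,≥0 _} {.a ,≥0 _} refl = refl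

zero≥0-+ : ∀ r → zero≥0 +≥0 r ≡ r
zero≥0-+ (a ,≥0 _) = ℚ≥0-ext (ℚP.+-identityˡ a)

max≥0-sel : ∀ r q → (max≥0 r q ≡ r) ⊎ (max≥0 r q ≡ q)
max≥0-sel (a ,≥0 _) (b ,≥0 _) with ℚP.⊔-sel a b
... | inj₁ e = inj₁ (ℚ≥0-ext e)
... | inj₂ e = inj₂ (ℚ≥0-ext e)

min≥0-sel : ∀ r q → (min≥0 r q ≡ r) ⊎ (min≥0 r q ≡ q)
min≥0-sel (a ,≥0 _) (b ,≥0 _) with ℚP.⊓-sel a b
... | inj₁ e = inj₁ (ℚ≥0-ext e)
... | inj₂ e = inj₂ (ℚ≥0-ext e)

zero-or-Pos : ∀ r → (zero≥0 ≡ r) ⊎ Pos r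
zero-or-Pos (a ,≥0 nonneg) with ℚP.<-cmp ℚ.0ℚ a
... | tri< 0<a _ _ = inj₂ 0<a
... | tri≈ _ 0≡a _ = inj₁ (ℚ≥0-ext 0≡a)
... | tri> _ _ a<0 =
  ⊥-elim (ℚP.<-irrefl refl (ℚP.<-≤-trans a<0 (recompute (ℚ.0ℚ ℚ.≤? a) nonneg)))

-- L_r φ → L_0 φ: for r > 0 this is A2 with lower index 0.
L-to-L₀ : ∀ {φ} r → ⊢ (L r φ ⇒ L zero≥0 φ)
L-to-L₀ {φ} r with zero-or-Pos r
... | inj₁ 0≡r = subst (λ s → ⊢ (L s φ ⇒ L zero≥0 φ)) 0≡r ⇒-refl
... | inj₂ 0<r = subst (λ s → ⊢ (L s φ ⇒ L zero≥0 φ)) (zero≥0-+ r) (A2 zero≥0 r 0<r)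

-- Replacement of provably equivalent formulas under L_r and M_r: R2 turns
-- the forward implication into the guard L_0 that R1/R1′ need for the
-- backward one.
L-replace : ∀ {a b} r → ⊢ (a ⇒ b) → ⊢ (b ⇒ a) → ⊢ (L r a ⇒ L r b)
L-replace r ab ba = ⇒-trans (⇒-∧-intro ⇒-refl (⇒-trans (L-to-L₀ r) (R2 ab))) (R1 r ba)

M-replace : ∀ {a b} r → ⊢ (a ⇒ b) → ⊢ (b ⇒ a) → ⊢ (M r a ⇒ M r b)
M-replace r ab ba = ⇒-trans (⇒-∧-intro ⇒-refl (⇒-trans (A7 r) (R2 ab))) (R1′ r ba)

L-cong : ∀ {a b} r → ⊢ (a ⇔ b) → ⊢ (L r a ⇔ L r b)
L-cong r a⇔b = ⇔-intro (L-replace r (⇔-elim→ a⇔b) (⇔-elim← a⇔b))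
                       (L-replace r (⇔-elim← a⇔b) (⇔-elim→ a⇔b))

M-cong : ∀ {a b} r → ⊢ (a ⇔ b) → ⊢ (M r a ⇔ M r b)
M-cong r a⇔b = ⇔-intro (M-replace r (⇔-elim→ a⇔b) (⇔-elim← a⇔b))
                       (M-replace r (⇔-elim← a⇔b) (⇔-elim→ a⇔b))

-- (T1): under the guard L_0(φ ∧ ψ), R1 transfers the lower bound of either
-- conjunct to the conjunction, in particular the larger one.
L-∧ : ∀ {φ ψ} r q →
  ⊢ ((L r φ ∧′ L q ψ ∧′ L zero≥0 (φ ∧′ ψ)) ⇒ L (max≥0 r q) (φ ∧′ ψ))
L-∧ r q with max≥0-sel r q
... | inj₁ max≡r rewrite max≡r = ⇒-trans ∧-forget-middle (R1 r ∧-elimˡ)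
... | inj₂ max≡q rewrite max≡q = ⇒-trans ∧-forget-first (R1 q ∧-elimʳ)

M-∧ : ∀ {φ ψ} r q →
  ⊢ ((M r φ ∧′ M q ψ ∧′ L zero≥0 (φ ∧′ ψ)) ⇒ M (min≥0 r q) (φ ∧′ ψ))
M-∧ r q with min≥0-sel r q
... | inj₁ min≡r rewrite min≡r = ⇒-trans ∧-forget-middle (R1′ r ∧-elimˡ)
... | inj₂ min≡q rewrite min≡q = ⇒-trans ∧-forget-first (R1′ q ∧-elimʳ)

-- (T3)/(T4): a refutable formula has no lower bound, since L_r a would give
-- L_0 a and then L_0 ⊥, against A1.
L-refutable : ∀ {a} r → ⊢ (a ⇒ ⊥′) → ⊢ (¬′ L r a)
L-refutable r a⇒⊥ = contrapose (⇒-trans (L-to-L₀ r) (R2 a⇒⊥)) A1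

-- (T5): M_r distributes over ∨ — A7 and A4 decide which disjunct has
-- L_0, and R1′ then transfers the upper bound to that disjunct.
M-∨ : ∀ {φ ψ} r → ⊢ (M r (φ ∨′ ψ) ⇒ (M r φ ∨′ M r ψ))
M-∨ r = ∨-cases (⇒-trans (A7 r) (A4 zero≥0))
                (⇒-trans (R1′ r ∨-introˡ) ∨-introˡ)
                (⇒-trans (R1′ r ∨-introʳ) ∨-introʳ)

lemma4p1 : (φ ψ : Form) (r q : ℚ≥0) →
    (⊢ ((L r φ ∧′ L q ψ ∧′ L zero≥0 (φ ∧′ ψ)) ⇒ L (max≥0 r q) (φ ∧′ ψ)))
    × (⊢ ((M r φ ∧′ M q ψ ∧′ L zero≥0 (φ ∧′ ψ)) ⇒ M (min≥0 r q) (φ ∧′ ψ)))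
    × ((⊢ (φ ⇔ ψ)) → ⊢ (L r φ ⇔ L r ψ))
    × ((⊢ (φ ⇔ ψ)) → ⊢ (M r φ ⇔ M r ψ))
    × (⊢ (¬′ L r ⊥′))
    × ((⊢ (φ ⇒ ⊥′)) → ⊢ (¬′ L r φ))
    × (⊢ (M r (φ ∨′ ψ) ⇒ (M r φ ∨′ M r ψ)))
lemma4p1 φ ψ r q =
  L-∧ r q , M-∧ r q , L-cong r , M-cong r ,
  L-refutable r ⇒-refl , L-refutable r , M-∨ r
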